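{- Fix $h\in\mathbb{Z}$ and $S\in\mathbb{Z}_{\ge 0}$, and set $T=S+h$; assume $T\neq 0$. Let $u\in\mathbb{Z}$ with $u\equiv S\pmod 2$. Put $\mathcal{L}(S,u)=S^5+10S^3u^2+5Su^4$ and $D_Z(S,u)=80T^6+20T\,\mathcal{L}(S,u)$. (a) There exists an integer $v$ with \[ 5Tv^4+10T^3v^2+\bigl(T^5-\mathcal{L}(S,u)\bigr)=0 \] and $v\equiv T\pmod 2$ (equivalently, there exist integers $c,d$ with $c+d=T$ and $v=d-c$) if and only if there exists an integer $Y$ such that: (1) $Y^2=D_Z(S,u)$; (2) $Z:=\dfrac{ -10T^3+Y}{10T}$ is a nonnegative integer; (3) $Z$ is a perfect square in $\mathbb{Z}$; (4) $Z\equiv T\pmod 2$. (b) If in addition $T\ge 0$, then such a $v$ can be chosen so that $c=(T-v)/2$ and $d=(T+v)/2$ satisfy $c,d\in\mathbb{Z}_{\ge0}$ if and only if there exists an integer $Y$ satisfying (1)–(4) and moreover (5) $Z\le T^2$ (equivalently $|v|\le T$). -}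

module Defs where

open import Data.Nat using (ℕ)
open import Data.Integer using (ℤ; +_; _+_; _-_; _*_; -_; _≤_; _^_)
open import Data.Integer.Divisibility using (_∣_)
open import Data.Product using (∃; ∃-syntax; _×_)
open import Relation.Binary.PropositionalEquality using (_≡_)

𝓛 : ℤ → ℤ → ℤ
𝓛 S u = S ^ 5 + + 10 * S ^ 3 * u ^ 2 + + 5 * S * u ^ 4

DZ : ℤ → ℤ → ℤ → ℤ
DZ T S u = + 80 * T ^ 6 + + 20 * T * 𝓛 S u

QuarticEq : ℤ → ℤ → ℤ → ℤ → Set
QuarticEq T S u v = + 5 * T * v ^ 4 + + 10 * T ^ 3 * v ^ 2 + (T ^ 5 - 𝓛 S u) ≡ + 0

_≡₂_ : ℤ → ℤ → Set
a ≡₂ b = + 2 ∣ (a - b)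

IsSquare : ℤ → Set
IsSquare z = ∃[ w ] z ≡ w * w

-- Z is the integer (-10 T^3 + Y)/(10 T): i.e. 10 T * Z = -10 T^3 + Y
IsZQuot : ℤ → ℤ → ℤ → Set
IsZQuot T Y Z = + 10 * T * Z ≡ - (+ 10 * T ^ 3) + Y

Cond1to4 : ℤ → ℤ → ℤ → ℤ → Set
Cond1to4 T S u Y = (Y * Y ≡ DZ T S u) ×
  ∃[ Z ] (IsZQuot T Y Z × + 0 ≤ Z × IsSquare Z × Z ≡₂ T)

Cond1to5 : ℤ → ℤ → ℤ → ℤ → Set
Cond1to5 T S u Y = (Y * Y ≡ DZ T S u) ×
  ∃[ Z ] (IsZQuot T Y Z × + 0 ≤ Z × IsSquare Z × Z ≡₂ T × Z ≤ T ^ 2)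

{-# OPTIONS --safe #-}
-- With Y := 10 T v² + 10 T³ one has Y² − D_Z(S,u) = 20 T · (5 T v⁴ + 10 T³ v² + T⁵ − 𝓛(S,u)),
-- so for T ≠ 0 the integer roots v of the quartic correspond to the square roots Y of D_Z
-- of this shape, and then Z = v².  The side conditions on v transfer to Z = v²:
-- v ≡ v² (mod 2), and for T ≥ 0 the halves c = (T − v)/2, d = (T + v)/2 satisfy
-- 4cd = T² − v² and c + d = T, so both are nonnegative exactly when v² ≤ T².
module Submission where

open import Defs
open import Data.Nat using (ℕ; suc; s≤s; z≤n)
open import Data.Integer
  using (ℤ; +_; -[1+_]; _+_; _-_; _*_; -_; _^_; _≤_; +≤+; _%ℕ_; _/ℕ_)
open import Data.Integer.Properties
  using (+-identityˡ; *-identityʳ; *-zeroʳ; +-inverseʳ; pos-*; i-j≡0⇒i≡j; i*j≡0⇒i≡0∨j≡0;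
         i≤j⇒0≤j-i; 0≤i-j⇒j≤i; *-cancelˡ-≤-pos)
open import Data.Integer.DivMod using (a≡a%ℕn+[a/ℕn]*n; n%ℕd<d)
open import Data.Integer.Divisibility.Signed
  using (_∣_; divides; ∣ᵤ⇒∣; ∣⇒∣ᵤ; ∣m∣n⇒∣m+n; ∣m⇒∣-m; ∣n⇒∣m*n; ∣m⇒∣m*n)
open import Data.Integer.Solver using (module +-*-Solver)
open import Data.Integer.Tactic.RingSolver using (solve-∀)
open import Data.Product using (∃-syntax; _×_; _,_)
open import Data.Sum using (_⊎_; inj₁; inj₂)
open import Function.Bundles using (_⇔_; mk⇔; Equivalence)
open import Relation.Binary.PropositionalEquality
  using (_≡_; _≢_; refl; sym; trans; cong; subst; module ≡-Reasoning)
open import Relation.Nullary.Negation using (contradiction)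

≡₂⇒∣ : ∀ a b → a ≡₂ b → + 2 ∣ a - b
≡₂⇒∣ _ _ = ∣ᵤ⇒∣

∣⇒≡₂ : ∀ a b → + 2 ∣ a - b → a ≡₂ b
∣⇒≡₂ _ _ = ∣⇒∣ᵤ

≡₂-sym : ∀ a b → a ≡₂ b → b ≡₂ a
≡₂-sym a b p = ∣⇒≡₂ b a (subst (+ 2 ∣_) (neg-diff a b) (∣m⇒∣-m (≡₂⇒∣ a b p)))
  where
  neg-diff : ∀ a b → - (a - b) ≡ b - a
  neg-diff = solve-∀

≡₂-trans : ∀ a b c → a ≡₂ b → b ≡₂ c → a ≡₂ c
≡₂-trans a b c p q =
  ∣⇒≡₂ a c (subst (+ 2 ∣_) (diff-+ a b c) (∣m∣n⇒∣m+n (≡₂⇒∣ a b p) (≡₂⇒∣ b c q)))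
  where
  diff-+ : ∀ a b c → (a - b) + (b - c) ≡ a - c
  diff-+ = solve-∀

2∣i⊎2∣i-1 : ∀ i → + 2 ∣ i ⊎ + 2 ∣ i - + 1
2∣i⊎2∣i-1 i with i %ℕ 2 | n%ℕd<d i 2 | a≡a%ℕn+[a/ℕn]*n i 2
... | suc (suc _) | s≤s (s≤s ()) | _
... | 0           | _             | i≡q*2   = inj₁ (divides (i /ℕ 2) (trans i≡q*2 (+-identityˡ _)))
... | 1           | _             | i≡1+q*2 =
  inj₂ (divides (i /ℕ 2) (trans (cong (_- + 1) i≡1+q*2) (drop-1 (i /ℕ 2))))
  where
  drop-1 : ∀ q → (+ 1 + q * + 2) - + 1 ≡ q * + 2
  drop-1 = solve-∀

i*i≡₂i : ∀ i → (i * i) ≡₂ i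
i*i≡₂i i = ∣⇒≡₂ (i * i) i (subst (+ 2 ∣_) (sym (i*i-i i)) (2∣i*[i-1] (2∣i⊎2∣i-1 i)))
  where
  i*i-i : ∀ i → i * i - i ≡ i * (i - + 1)
  i*i-i = solve-∀
  2∣i*[i-1] : + 2 ∣ i ⊎ + 2 ∣ i - + 1 → + 2 ∣ i * (i - + 1)
  2∣i*[i-1] (inj₁ 2∣i)   = ∣m⇒∣m*n (i - + 1) 2∣i
  2∣i*[i-1] (inj₂ 2∣i-1) = ∣n⇒∣m*n i 2∣i-1

≡₂⇔square≡₂ : ∀ i j → i ≡₂ j ⇔ (i * i) ≡₂ j
≡₂⇔square≡₂ i j = mk⇔ (≡₂-trans (i * i) i j (i*i≡₂i i))
                       (≡₂-trans i (i * i) j (≡₂-sym (i * i) i (i*i≡₂i i)))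

halves⇒≡₂ : ∀ {c d T v} → c + d ≡ T → v ≡ d - c → v ≡₂ T
halves⇒≡₂ {c} {d} refl refl = ∣⇒≡₂ (d - c) (c + d) (divides (- c) (diff c d))
  where
  diff : ∀ c d → (d - c) - (c + d) ≡ (- c) * + 2
  diff = solve-∀

≡₂⇒halves : ∀ v T → v ≡₂ T → ∃[ c ] ∃[ d ] (c + d ≡ T × v ≡ d - c)
≡₂⇒halves v T v≡₂T with ≡₂⇒∣ T v (≡₂-sym v T v≡₂T)
... | divides k T-v≡k*2 = k , k + v , sum , diff k v
  where
  sum : k + (k + v) ≡ T
  sum = begin
    k + (k + v)   ≡⟨ regroup k v ⟩
    k * + 2 + v   ≡⟨ cong (_+ v) T-v≡k*2 ⟨
    (T - v) + v   ≡⟨ cancel T v ⟩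
    T             ∎
    where
    open ≡-Reasoning
    regroup : ∀ k v → k + (k + v) ≡ k * + 2 + v
    regroup = solve-∀
    cancel : ∀ T v → (T - v) + v ≡ T
    cancel = solve-∀
  diff : ∀ k v → v ≡ (k + v) - k
  diff = solve-∀

halves-square-gap : ∀ {c d T v} → c + d ≡ T → v ≡ d - c → T * T - v * v ≡ + 4 * (c * d)
halves-square-gap {c} {d} refl refl = gap c d
  where
  gap : ∀ c d → (c + d) * (c + d) - (d - c) * (d - c) ≡ + 4 * (c * d)
  gap = solve-∀

0≤i∧0≤j⇒0≤i*j : ∀ {i j} → + 0 ≤ i → + 0 ≤ j → + 0 ≤ i * j
0≤i∧0≤j⇒0≤i*j {+ m} {+ n} _ _ = subst (+ 0 ≤_) (pos-* m n) (+≤+ z≤n)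

0≤i*j∧0≤i+j⇒0≤i∧0≤j : ∀ {i j} → + 0 ≤ i * j → + 0 ≤ i + j → + 0 ≤ i × + 0 ≤ j
0≤i*j∧0≤i+j⇒0≤i∧0≤j {+ _}      {+ _}            _  _  = +≤+ z≤n , +≤+ z≤n
0≤i*j∧0≤i+j⇒0≤i∧0≤j {+ 0}      { -[1+ _ ]}       _  ()
0≤i*j∧0≤i+j⇒0≤i∧0≤j {+ suc _}  { -[1+ _ ]}       () _
0≤i*j∧0≤i+j⇒0≤i∧0≤j { -[1+ _ ]} {+ 0}            _  ()
0≤i*j∧0≤i+j⇒0≤i∧0≤j { -[1+ _ ]} {+ suc _}        () _
0≤i*j∧0≤i+j⇒0≤i∧0≤j { -[1+ _ ]} { -[1+ _ ]}       _  ()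

0≤i*i : ∀ i → + 0 ≤ i * i
0≤i*i (+ 0)      = +≤+ z≤n
0≤i*i (+ suc _)  = +≤+ z≤n
0≤i*i -[1+ _ ]   = +≤+ z≤n

halves⇒[square≤^2⇔0≤*] : ∀ {c d T v} → c + d ≡ T → v ≡ d - c → v * v ≤ T ^ 2 ⇔ + 0 ≤ c * d
halves⇒[square≤^2⇔0≤*] {c} {d} {T} {v} c+d≡T v≡d-c = mk⇔ ⇒ ⇐
  where
  gap : T * T - v * v ≡ + 4 * (c * d)
  gap = halves-square-gap {c} {d} c+d≡T v≡d-c
  T^2≡T*T : T ^ 2 ≡ T * T
  T^2≡T*T = cong (T *_) (*-identityʳ T)
  ⇒ : v * v ≤ T ^ 2 → + 0 ≤ c * d
  ⇒ v*v≤T^2 = *-cancelˡ-≤-pos (+ 0) (c * d) (+ 4)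
    (subst (+ 0 ≤_) gap (i≤j⇒0≤j-i (subst (v * v ≤_) T^2≡T*T v*v≤T^2)))
  ⇐ : + 0 ≤ c * d → v * v ≤ T ^ 2
  ⇐ 0≤cd = subst (v * v ≤_) (sym T^2≡T*T)
    (0≤i-j⇒j≤i (subst (+ 0 ≤_) (sym gap) (0≤i∧0≤j⇒0≤i*j {+ 4} (+≤+ z≤n) 0≤cd)))

NonNegHalves : ℤ → ℤ → Set
NonNegHalves T v = ∃[ c ] ∃[ d ] (c + d ≡ T × v ≡ d - c × + 0 ≤ c × + 0 ≤ d)

NonNegHalves⇔≡₂∧≤^2 : ∀ {T v} → + 0 ≤ T → NonNegHalves T v ⇔ ((v * v) ≡₂ T × v * v ≤ T ^ 2)
NonNegHalves⇔≡₂∧≤^2 {T} {v} 0≤T = mk⇔ ⇒ ⇐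
  where
  ⇒ : NonNegHalves T v → (v * v) ≡₂ T × v * v ≤ T ^ 2
  ⇒ (c , d , c+d≡T , v≡d-c , 0≤c , 0≤d) =
    Equivalence.to (≡₂⇔square≡₂ v T) (halves⇒≡₂ {c} {d} c+d≡T v≡d-c) ,
    Equivalence.from (halves⇒[square≤^2⇔0≤*] {c} {d} c+d≡T v≡d-c) (0≤i∧0≤j⇒0≤i*j {c} {d} 0≤c 0≤d)
  ⇐ : (v * v) ≡₂ T × v * v ≤ T ^ 2 → NonNegHalves T v
  ⇐ (v*v≡₂T , v*v≤T^2) = nonNeg (≡₂⇒halves v T (Equivalence.from (≡₂⇔square≡₂ v T) v*v≡₂T))
    where
    nonNeg : ∃[ c ] ∃[ d ] (c + d ≡ T × v ≡ d - c) → NonNegHalves T v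
    nonNeg (c , d , c+d≡T , v≡d-c) = c , d , c+d≡T , v≡d-c , 0≤i*j∧0≤i+j⇒0≤i∧0≤j {c} {d}
      (Equivalence.to (halves⇒[square≤^2⇔0≤*] {c} {d} c+d≡T v≡d-c) v*v≤T^2)
      (subst (+ 0 ≤_) (sym c+d≡T) 0≤T)

quartic : ℤ → ℤ → ℤ → ℤ → ℤ
quartic T S u v = + 5 * T * v ^ 4 + + 10 * T ^ 3 * v ^ 2 + (T ^ 5 - 𝓛 S u)

root : ℤ → ℤ → ℤ
root T Z = + 10 * T * Z + + 10 * T ^ 3

root²-DZ≡20T*quartic : ∀ T S u v →
  root T (v * v) * root T (v * v) - DZ T S u ≡ + 20 * T * quartic T S u v
root²-DZ≡20T*quartic T S u v = identity T (𝓛 S u) v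
  where
  -- solve-∀ cannot reflect _^_ on ℤ, so the identity goes through the explicit solver.
  open +-*-Solver
  identity : ∀ T L v →
    (+ 10 * T * (v * v) + + 10 * T ^ 3) * (+ 10 * T * (v * v) + + 10 * T ^ 3) - (+ 80 * T ^ 6 + + 20 * T * L)
      ≡ + 20 * T * (+ 5 * T * v ^ 4 + + 10 * T ^ 3 * v ^ 2 + (T ^ 5 - L))
  identity = solve 3 (λ T L v →
    (con (+ 10) :* T :* (v :* v) :+ con (+ 10) :* T :^ 3) :* (con (+ 10) :* T :* (v :* v) :+ con (+ 10) :* T :^ 3)
      :- (con (+ 80) :* T :^ 6 :+ con (+ 20) :* T :* L)
    := con (+ 20) :* T :* (con (+ 5) :* T :* v :^ 4 :+ con (+ 10) :* T :^ 3 :* v :^ 2 :+ (T :^ 5 :- L))) refl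

20T*i≡0⇒i≡0 : ∀ {T i} → T ≢ + 0 → + 20 * T * i ≡ + 0 → i ≡ + 0
20T*i≡0⇒i≡0 {T} T≢0 20Ti≡0 with i*j≡0⇒i≡0∨j≡0 (+ 20 * T) 20Ti≡0
... | inj₂ i≡0  = i≡0
... | inj₁ 20T≡0 with i*j≡0⇒i≡0∨j≡0 (+ 20) 20T≡0
...   | inj₁ ()
...   | inj₂ T≡0 = contradiction T≡0 T≢0

QuarticEq⇔root²≡DZ : ∀ {T S u v} → T ≢ + 0 →
  QuarticEq T S u v ⇔ (root T (v * v) * root T (v * v) ≡ DZ T S u)
QuarticEq⇔root²≡DZ {T} {S} {u} {v} T≢0 = mk⇔ ⇒ ⇐
  where
  open ≡-Reasoning
  y : ℤ
  y = root T (v * v)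
  ⇒ : QuarticEq T S u v → y * y ≡ DZ T S u
  ⇒ q≡0 = i-j≡0⇒i≡j (y * y) (DZ T S u) (begin
    y * y - DZ T S u           ≡⟨ root²-DZ≡20T*quartic T S u v ⟩
    + 20 * T * quartic T S u v ≡⟨ cong (+ 20 * T *_) q≡0 ⟩
    + 20 * T * + 0             ≡⟨ *-zeroʳ (+ 20 * T) ⟩
    + 0                        ∎)
  ⇐ : y * y ≡ DZ T S u → QuarticEq T S u v
  ⇐ y*y≡DZ = 20T*i≡0⇒i≡0 {T} {quartic T S u v} T≢0 (begin
    + 20 * T * quartic T S u v ≡⟨ root²-DZ≡20T*quartic T S u v ⟨
    y * y - DZ T S u           ≡⟨ cong (_- DZ T S u) y*y≡DZ ⟩
    DZ T S u - DZ T S u        ≡⟨ +-inverseʳ (DZ T S u) ⟩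
    + 0                        ∎)

IsZQuot⇔≡root : ∀ {T Y Z} → IsZQuot T Y Z ⇔ Y ≡ root T Z
IsZQuot⇔≡root {T} {Y} {Z} =
  mk⇔ (λ eq → trans (shift (+ 10 * T ^ 3) Y) (cong (_+ + 10 * T ^ 3) (sym eq)))
      (λ { refl → unshift (+ 10 * T * Z) (+ 10 * T ^ 3) })
  where
  shift : ∀ b Y → Y ≡ (- b + Y) + b
  shift = solve-∀
  unshift : ∀ a b → a ≡ - b + (a + b)
  unshift = solve-∀

roots⇔squareRoots : ∀ T S u → T ≢ + 0 → (P R : ℤ → Set) → (∀ v → P v ⇔ R (v * v)) →
  (∃[ v ] (QuarticEq T S u v × P v)) ⇔
  (∃[ Y ] (Y * Y ≡ DZ T S u × ∃[ Z ] (IsZQuot T Y Z × + 0 ≤ Z × IsSquare Z × R Z)))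
roots⇔squareRoots T S u T≢0 P R P⇔R = mk⇔ ⇒ ⇐
  where
  ⇒ : ∃[ v ] (QuarticEq T S u v × P v) →
      ∃[ Y ] (Y * Y ≡ DZ T S u × ∃[ Z ] (IsZQuot T Y Z × + 0 ≤ Z × IsSquare Z × R Z))
  ⇒ (v , q≡0 , Pv) =
    root T (v * v) , Equivalence.to (QuarticEq⇔root²≡DZ {T} {S} {u} {v} T≢0) q≡0 ,
    v * v , Equivalence.from (IsZQuot⇔≡root {T} {root T (v * v)} {v * v}) refl ,
    0≤i*i v , (v , refl) , Equivalence.to (P⇔R v) Pv
  ⇐ : ∃[ Y ] (Y * Y ≡ DZ T S u × ∃[ Z ] (IsZQuot T Y Z × + 0 ≤ Z × IsSquare Z × R Z)) →
      ∃[ v ] (QuarticEq T S u v × P v)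
  ⇐ (Y , Y*Y≡DZ , .(v * v) , quot , _ , (v , refl) , Rv*v) =
    v , Equivalence.from (QuarticEq⇔root²≡DZ {T} {S} {u} {v} T≢0) root²≡DZ , Equivalence.from (P⇔R v) Rv*v
    where
    root²≡DZ : root T (v * v) * root T (v * v) ≡ DZ T S u
    root²≡DZ = subst (λ y → y * y ≡ DZ T S u)
                     (Equivalence.to (IsZQuot⇔≡root {T} {Y} {v * v}) quot) Y*Y≡DZ

proposition3p3 : (h : ℤ) (S : ℕ) (u : ℤ) → (+ S + h) ≢ + 0 → u ≡₂ (+ S) →
    ((∃[ v ] (QuarticEq (+ S + h) (+ S) u v × v ≡₂ (+ S + h)))
    ⇔ (∃[ Y ] Cond1to4 (+ S + h) (+ S) u Y))
    × (+ 0 ≤ (+ S + h) →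
    ((∃[ v ] (QuarticEq (+ S + h) (+ S) u v × ∃[ c ] ∃[ d ] (c + d ≡ (+ S + h) × v ≡ d - c × + 0 ≤ c × + 0 ≤ d)))
    ⇔ (∃[ Y ] Cond1to5 (+ S + h) (+ S) u Y)))
proposition3p3 h S u T≢0 _ =
  roots⇔squareRoots T (+ S) u T≢0 (_≡₂ T) (_≡₂ T) (λ v → ≡₂⇔square≡₂ v T) ,
  λ 0≤T → roots⇔squareRoots T (+ S) u T≢0 (NonNegHalves T) (λ Z → Z ≡₂ T × Z ≤ T ^ 2)
                             (λ v → NonNegHalves⇔≡₂∧≤^2 0≤T)
  where
  T : ℤ
  T = + S + h
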